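{- Let $G$ be a finite graph on $n$ vertices and $k$ a natural number, and let $\mathcal{B}$ be either $\mathcal{B}(G)$, or $\mathcal{B}_{\geq k}(G)$ with $k\le n-1$. Let $P\in V(\mathcal{B})$. If $P$ has a part $\{u_1,u_2,u_3\}$ of size $3$ and a part $\{v\}$ of size $1$ such that some $u_j$ is not adjacent to $v$ in $G$, then $P$ does not satisfy Property 2.
   Context: An independent set partition of $G$ is a partition of $V(G)$ into nonempty independent sets (parts). For such a partition $P$ and $v\in V(G)$, let $P-v$ be the partition of $V(G)\setminus\{v\}$ obtained by deleting $v$ from its part (discarding that part if empty). The Bell colouring graph $\mathcal{B}(G)$ has as vertices the independent set partitions of $G$, with $P\neq Q$ adjacent iff $P-v=Q-v$ for some $v\in V(G)$; $\mathcal{B}_{\geq k}(G)$ is its induced subgraph on partitions with at least $k$ parts. For $P\in V(\mathcal{B})$, $N(P)$ is its set of neighbours in $\mathcal{B}$ and $N[P]=N(P)\cup\{P\}$. Property 2 (of $P$ in $\mathcal{B}$): whenever $Q_1,Q_2,Q_3\in N(P)$ are pairwise adjacent in $\mathcal{B}$ and have a common neighbour $R\notin N[P]$, every other neighbour of $P$ is adjacent to either zero or exactly two of $Q_1,Q_2,Q_3$. -}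

module Defs where

open import Data.Nat using (ℕ; zero; suc; _≤_; _∸_; _<ᵇ_)
open import Data.Bool using (Bool; true; false; not; _∧_; if_then_else_)
open import Data.Fin using (Fin; toℕ)
open import Data.List using (List; allFin; map)
open import Data.Bool.ListAction using (any)
open import Data.Nat.ListAction using (sum)
open import Data.Unit using (⊤)
open import Data.Product using (Σ; _×_; _,_; ∃)
open import Data.Sum using (_⊎_)
open import Relation.Nullary using (¬_)
open import Relation.Binary.PropositionalEquality using (_≡_)

record Graph (n : ℕ) : Set where
  field
    adj     : Fin n → Fin n → Bool
    adj-sym : ∀ x y → adj x y ≡ adj y x
    adj-irr : ∀ x → adj x x ≡ false
open Graph public

-- An independent set partition of V(G), represented by its "same part" equivalence relation.
-- Parts are exactly the equivalence classes (hence automatically nonempty).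
record ISPartition {n : ℕ} (G : Graph n) : Set where
  field
    same       : Fin n → Fin n → Bool
    same-refl  : ∀ x → same x x ≡ true
    same-sym   : ∀ x y → same x y ≡ same y x
    same-trans : ∀ x y z → same x y ≡ true → same y z ≡ true → same x z ≡ true
    indep      : ∀ x y → same x y ≡ true → adj G x y ≡ false
open ISPartition public

module _ {n : ℕ} {G : Graph n} where

  _≈P_ : ISPartition G → ISPartition G → Set
  P ≈P Q = ∀ x y → same P x y ≡ same Q x y

  -- P - v = Q - v : the partitions agree on V(G) ∖ {v}.
  AgreeOff : Fin n → ISPartition G → ISPartition G → Set
  AgreeOff v P Q = ∀ x y → ¬ (x ≡ v) → ¬ (y ≡ v) → same P x y ≡ same Q x y

  -- Number of parts: number of vertices that are the least element of their part.
  isLeader : ISPartition G → Fin n → Bool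
  isLeader P i = not (any (λ j → (toℕ j <ᵇ toℕ i) ∧ same P j i) (allFin n))

  numParts : ISPartition G → ℕ
  numParts P = sum (map (λ i → if isLeader P i then 1 else 0) (allFin n))

-- Which Bell colouring graph: B(G), or B_{≥k}(G) with k ≤ n-1.
data Mode (n : ℕ) : Set where
  full    : Mode n
  atLeast : (k : ℕ) → k ≤ n ∸ 1 → Mode n

InB : {n : ℕ} {G : Graph n} → Mode n → ISPartition G → Set
InB full          P = ⊤
InB (atLeast k _) P = k ≤ numParts P

module _ {n : ℕ} {G : Graph n} (M : Mode n) where

  AdjB : ISPartition G → ISPartition G → Set
  AdjB P Q = InB M P × InB M Q × ¬ (P ≈P Q) × ∃ (λ v → AgreeOff v P Q)

  Property2 : ISPartition G → Set
  Property2 P =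
    (Q₁ Q₂ Q₃ R : ISPartition G) →
    AdjB P Q₁ → AdjB P Q₂ → AdjB P Q₃ →
    AdjB Q₁ Q₂ → AdjB Q₁ Q₃ → AdjB Q₂ Q₃ →
    AdjB Q₁ R → AdjB Q₂ R → AdjB Q₃ R →
    ¬ (R ≈P P) → ¬ AdjB P R →
    (S : ISPartition G) → AdjB P S →
    ¬ (S ≈P Q₁) → ¬ (S ≈P Q₂) → ¬ (S ≈P Q₃) →
    (¬ AdjB S Q₁ × ¬ AdjB S Q₂ × ¬ AdjB S Q₃)
    ⊎ (AdjB S Q₁ × AdjB S Q₂ × ¬ AdjB S Q₃)
    ⊎ (AdjB S Q₁ × ¬ AdjB S Q₂ × AdjB S Q₃)
    ⊎ (¬ AdjB S Q₁ × AdjB S Q₂ × AdjB S Q₃)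

{-# OPTIONS --safe #-}
module Submission where

-- Write the part as {u₀, u₁, u₂} with u₀ and v non-adjacent (permuting u if necessary).
-- Let Q₁, Q₂, Q₃ be P with u₀, u₁, u₂ respectively moved to a new singleton part, R be P
-- with all three made singletons, and S be P with u₀ moved into the part {v}. Then
-- Q₁, Q₂, Q₃ are pairwise adjacent neighbours of P with the common neighbour R ∉ N[P],
-- while the neighbour S of P is adjacent to Q₁ but to neither Q₂ nor Q₃, so Property 2
-- fails. None of these partitions has fewer parts than P: isolating a vertex that is not
-- alone in its part adds exactly one part, and Q₁ arises in this way both from P and
-- from S. All of them agree with P away from {v, u₀, u₁, u₂}, so each is described by
-- labels on these four vertices, and the adjacencies among them are decided by
-- computing with the labels.

open import Defs
open import Data.Nat using (ℕ)
open import Data.Fin using (Fin; zero)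
open import Data.Bool using (true; false)
open import Data.Product using (_×_; ∃)
open import Relation.Nullary using (¬_)
open import Relation.Binary.PropositionalEquality using (_≡_)
open import Function.Definitions using (Injective)

open import Data.Bool using (Bool; not; _∧_; if_then_else_)
import Data.Bool as Bool
open import Data.Bool.ListAction using (any)
open import Data.Bool.Properties using (T-∧; T-≡; not-involutive; ¬-not)
open import Data.Fin using (suc; toℕ; _<_)
open import Data.Fin.Induction using (<-wellFounded)
open import Data.Fin.Patterns using (0F; 1F; 2F; 3F)
open import Data.Fin.Permutation using (Permutation′; _⟨$⟩ʳ_; _⟨$⟩ˡ_; inverseˡ; inverseʳ; transpose)
open import Data.Fin.Properties using (<-cmp; <-irrefl; _≟_; any?; all?)
import Data.Fin.Properties as Fin
open import Data.List using (map; allFin; tabulate)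
open import Data.List.Membership.Propositional using (lose)
open import Data.List.Membership.Propositional.Properties using (∈-allFin)
open import Data.List.Properties using (map-tabulate; tabulate-cong)
open import Data.List.Relation.Unary.Any using (satisfied)
open import Data.List.Relation.Unary.Any.Properties using (any⁺; any⁻)
open import Data.Nat using (suc; _+_; _≤_; _<ᵇ_)
import Data.Nat as ℕ
open import Data.Nat.ListAction using (sum)
open import Data.Nat.Properties
  using (≤-trans; ≤-reflexive; n≤1+n; +-assoc; +-comm; +-identityʳ; <ᵇ⇒<; <⇒<ᵇ; suc-injective; +-commutativeSemigroup)
open import Algebra.Properties.CommutativeSemigroup +-commutativeSemigroup using (xy∙z≈zy∙x)
open import Data.Product using (_,_; proj₁; proj₂)
open import Data.Sum using (_⊎_; inj₁; inj₂)
open import Data.Unit using (tt)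
open import Data.Vec.Functional using (_∷_; [])
open import Function using (_∘_; flip; case_of_; Equivalence; mk⇔)
open import Induction.WellFounded using (Acc; acc)
open import Relation.Binary.Definitions using (tri<; tri≈; tri>)
open import Relation.Binary.PropositionalEquality using (_≢_; refl; sym; trans; cong; cong₂; subst; module ≡-Reasoning)
open import Relation.Nullary using (Dec; yes; no; does; ¬?; contradiction)
open import Relation.Nullary.Decidable using (True; False; toWitness; toWitnessFalse; dec-true; does-⇔; _→-dec_)

true≢false : true ≢ false
true≢false ()

does-sound : ∀ {A : Set} (a? : Dec A) → does a? ≡ true → A
does-sound (yes a) _ = a

∑ : ∀ {n} → (Fin n → ℕ) → ℕ
∑ {n} f = sum (map f (allFin n))

∑-tabulate : ∀ {n} (f : Fin n → ℕ) → ∑ f ≡ sum (tabulate f)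
∑-tabulate f = cong sum (map-tabulate (λ i → i) f)

sum-tabulate-exchange : ∀ {n} (f g : Fin n → ℕ) t → (∀ i → i ≢ t → f i ≡ g i) →
  sum (tabulate f) + g t ≡ sum (tabulate g) + f t
sum-tabulate-exchange f g zero f≡g = begin
  (f zero + F) + g zero ≡⟨ cong (λ H → (f zero + H) + g zero) F≡G ⟩
  (f zero + G) + g zero ≡⟨ xy∙z≈zy∙x (f zero) G (g zero) ⟩
  (g zero + G) + f zero ∎
  where
  open ≡-Reasoning
  F = sum (tabulate (f ∘ suc))
  G = sum (tabulate (g ∘ suc))
  F≡G : F ≡ G
  F≡G = cong sum (tabulate-cong λ i → f≡g (suc i) λ ())
sum-tabulate-exchange f g (suc t) f≡g = begin
  (f zero + F) + g (suc t) ≡⟨ +-assoc (f zero) F (g (suc t)) ⟩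
  f zero + (F + g (suc t)) ≡⟨ cong₂ _+_ (f≡g zero λ ()) (sum-tabulate-exchange (f ∘ suc) (g ∘ suc) t f≡g-off-t) ⟩
  g zero + (G + f (suc t)) ≡⟨ +-assoc (g zero) G (f (suc t)) ⟨
  (g zero + G) + f (suc t) ∎
  where
  open ≡-Reasoning
  F = sum (tabulate (f ∘ suc))
  G = sum (tabulate (g ∘ suc))
  f≡g-off-t : ∀ i → i ≢ t → f (suc i) ≡ g (suc i)
  f≡g-off-t i i≢t = f≡g (suc i) (i≢t ∘ Fin.suc-injective)

∑-exchange : ∀ {n} (f g : Fin n → ℕ) t → (∀ i → i ≢ t → f i ≡ g i) → ∑ f + g t ≡ ∑ g + f t
∑-exchange f g t f≡g rewrite ∑-tabulate f | ∑-tabulate g = sum-tabulate-exchange f g t f≡g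

m≡1+n⇒n≤m : ∀ {m n} → m ≡ suc n → n ≤ m
m≡1+n⇒n≤m m≡1+n = subst (_ ≤_) (sym m≡1+n) (n≤1+n _)

count : Bool → ℕ
count b = if b then 1 else 0

∑-count-flip : ∀ {n} (p q : Fin n → Bool) t → (∀ i → i ≢ t → p i ≡ q i) → p t ≡ false → q t ≡ true →
  ∑ (count ∘ q) ≡ suc (∑ (count ∘ p))
∑-count-flip p q t p≡q pt qt = begin
  ∑ (count ∘ q)                 ≡⟨ +-identityʳ _ ⟨
  ∑ (count ∘ q) + 0             ≡⟨ cong (λ b → ∑ (count ∘ q) + count b) pt ⟨
  ∑ (count ∘ q) + count (p t)   ≡⟨ ∑-exchange (count ∘ p) (count ∘ q) t (λ i i≢t → cong count (p≡q i i≢t)) ⟨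
  ∑ (count ∘ p) + count (q t)   ≡⟨ cong (λ b → ∑ (count ∘ p) + count b) qt ⟩
  ∑ (count ∘ p) + 1             ≡⟨ +-comm _ 1 ⟩
  suc (∑ (count ∘ p))           ∎
  where open ≡-Reasoning

module _ {n : ℕ} {G : Graph n} (X : ISPartition G) where

  ¬isLeader : ∀ {i j} → j < i → same X j i ≡ true → isLeader X i ≢ true
  ¬isLeader {i} {j} j<i sji isLeader-i = true≢false (trans (sym isLeader-i) (cong not someSmaller))
    where
    someSmaller : any (λ j → (toℕ j <ᵇ toℕ i) ∧ same X j i) (allFin n) ≡ true
    someSmaller = Equivalence.to T-≡ (any⁺ _ (lose (∈-allFin j)
      (Equivalence.from T-∧ (<⇒<ᵇ j<i , Equivalence.from T-≡ sji))))

  isLeader-false⁻ : ∀ {i} → isLeader X i ≡ false → ∃ λ j → j < i × same X j i ≡ true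
  isLeader-false⁻ {i} notLeader
    with j , j<i∧sji ← satisfied (any⁻ _ (allFin n)
                         (Equivalence.from T-≡ (trans (sym (not-involutive _)) (cong not notLeader))))
    with j<ᵇi , sji ← Equivalence.to T-∧ j<i∧sji
    = j , <ᵇ⇒< _ _ j<ᵇi , Equivalence.to T-≡ sji

  isLeader-true⁺ : ∀ {i} → (∀ {j} → j < i → same X j i ≢ true) → isLeader X i ≡ true
  isLeader-true⁺ {i} noSmaller with isLeader X i in leader?
  ... | true  = refl
  ... | false with j , j<i , sji ← isLeader-false⁻ leader? = contradiction sji (noSmaller j<i)

  leaders-unique : ∀ {i j} → isLeader X i ≡ true → isLeader X j ≡ true → same X i j ≡ true → i ≡ j
  leaders-unique {i} {j} li lj sij with <-cmp i j
  ... | tri< i<j _ _ = contradiction lj (¬isLeader i<j sij)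
  ... | tri≈ _ i≡j _ = i≡j
  ... | tri> _ _ j<i = contradiction li (¬isLeader j<i (trans (same-sym X j i) sij))

  leader-exists : ∀ y → ∃ λ s → isLeader X s ≡ true × same X s y ≡ true
  leader-exists y = go y (<-wellFounded y)
    where
    go : ∀ y → Acc _<_ y → ∃ λ s → isLeader X s ≡ true × same X s y ≡ true
    go y (acc smaller) with isLeader X y in leader?
    ... | true  = y , leader? , same-refl X y
    ... | false with j , j<y , sjy ← isLeader-false⁻ leader?
                with s , ls , ssj ← go j (smaller j<y)
                = s , ls , same-trans X s j y ssj sjy

module _ {n : ℕ} {G : Graph n} {X Y : ISPartition G} {x y : Fin n}
  (X≈Y-off-x : AgreeOff x X Y) (x-alone : ∀ z → same Y x z ≡ true → z ≡ x)
  (y≢x : y ≢ x) (sxy : same X x y ≡ true) where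

  private
    sameY⁺ : ∀ {i j} → i ≢ x → j ≢ x → same X i j ≡ true → same Y i j ≡ true
    sameY⁺ i≢x j≢x sij = trans (sym (X≈Y-off-x _ _ i≢x j≢x)) sij

    sameX⁺ : ∀ {i j} → i ≢ x → j ≢ x → same Y i j ≡ true → same X i j ≡ true
    sameX⁺ i≢x j≢x sij = trans (X≈Y-off-x _ _ i≢x j≢x) sij

    x-leadsY : isLeader Y x ≡ true
    x-leadsY = isLeader-true⁺ Y λ {j} j<x sjx → <-irrefl (x-alone j (trans (same-sym Y x j) sjx)) j<x

    isLeaderY⁺ : ∀ {i} → i ≢ x → isLeader X i ≡ true → isLeader Y i ≡ true
    isLeaderY⁺ {i} i≢x i-leadsX = isLeader-true⁺ Y λ {j} j<i sji →
      ¬isLeader X j<i (sameX⁺ (λ { refl → i≢x (x-alone i sji) }) i≢x sji) i-leadsX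

    -- s is the least vertex of the part of x in X other than x; the new leader in Y is the
    -- larger of x and s, and it is the only vertex whose leadership changes.
    s : Fin n
    s = proj₁ (leader-exists Y y)

    s-leadsY : isLeader Y s ≡ true
    s-leadsY = proj₁ (proj₂ (leader-exists Y y))

    syY : same Y s y ≡ true
    syY = proj₂ (proj₂ (leader-exists Y y))

    s≢x : s ≢ x
    s≢x s≡x = y≢x (x-alone y (subst (λ z → same Y z y ≡ true) s≡x syY))

    sxs : same X x s ≡ true
    sxs = same-trans X x y s sxy (sameX⁺ y≢x s≢x (trans (same-sym Y y s) syY))

    joins-s : ∀ {i} → i ≢ x → same X x i ≡ true → same Y i s ≡ true
    joins-s i≢x sxi = sameY⁺ i≢x s≢x (same-trans X _ x s (trans (same-sym X _ x) sxi) sxs)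

    isLeader-stable : ∀ {i} → i ≢ x → i ≢ s → isLeader X i ≡ isLeader Y i
    isLeader-stable {i} i≢x i≢s with isLeader Y i in i-leadsY?
    ... | false = ¬-not λ i-leadsX → true≢false (trans (sym (isLeaderY⁺ i≢x i-leadsX)) i-leadsY?)
    ... | true  = isLeader-true⁺ X λ {j} j<i sji → case j ≟ x of λ where
      (yes refl) → i≢s (leaders-unique Y i-leadsY? s-leadsY (joins-s i≢x sji))
      (no j≢x)   → ¬isLeader Y j<i (sameY⁺ j≢x i≢x sji) i-leadsY?

    x-or-s-leadsX : isLeader X x ≡ true ⊎ isLeader X s ≡ true
    x-or-s-leadsX with ℓ , ℓ-leadsX , sℓx ← leader-exists X x | ℓ ≟ x
    ... | yes refl = inj₁ ℓ-leadsX
    ... | no ℓ≢x   = inj₂ (subst (λ z → isLeader X z ≡ true) ℓ≡s ℓ-leadsX)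
      where
      ℓ≡s : ℓ ≡ s
      ℓ≡s = leaders-unique Y (isLeaderY⁺ ℓ≢x ℓ-leadsX) s-leadsY (joins-s ℓ≢x (trans (same-sym X x ℓ) sℓx))

    ¬x-and-s-leadX : isLeader X x ≡ true → isLeader X s ≢ true
    ¬x-and-s-leadX x-leadsX s-leadsX = s≢x (sym (leaders-unique X x-leadsX s-leadsX sxs))

    new-leader : ∃ λ t → isLeader X t ≡ false × isLeader Y t ≡ true × (∀ i → i ≢ t → isLeader X i ≡ isLeader Y i)
    new-leader with x-or-s-leadsX
    ... | inj₁ x-leadsX = s , ¬-not (¬x-and-s-leadX x-leadsX) , s-leadsY , λ i i≢s → case i ≟ x of λ where
      (yes refl) → trans x-leadsX (sym x-leadsY)
      (no i≢x)   → isLeader-stable i≢x i≢s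
    ... | inj₂ s-leadsX = x , ¬-not (flip ¬x-and-s-leadX s-leadsX) , x-leadsY , λ i i≢x → case i ≟ s of λ where
      (yes refl) → trans s-leadsX (sym s-leadsY)
      (no i≢s)   → isLeader-stable i≢x i≢s

  numParts-isolate : numParts Y ≡ suc (numParts X)
  numParts-isolate with t , t-leadsX , t-leadsY , stable ← new-leader =
    ∑-count-flip (isLeader X) (isLeader Y) t stable t-leadsX t-leadsY

-- relabel ℓ keeps the parts of P that avoid the image of w (a union of parts of P) and
-- regroups the vertices w i according to their labels ℓ i.
module Relabelling {n m : ℕ} {G : Graph n} (P : ISPartition G)
  (w : Fin m → Fin n) (w-injective : Injective _≡_ _≡_ w)
  (w-closed : ∀ i x → same P (w i) x ≡ true → ∃ λ j → x ≡ w j) where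

  Labelling : Set
  Labelling = Fin m → ℕ

  sameLabel : Labelling → Fin m → Fin m → Bool
  sameLabel ℓ i j = does (ℓ i ℕ.≟ ℓ j)

  Valid : Labelling → Set
  Valid ℓ = ∀ i j → ℓ i ≡ ℓ j → adj G (w i) (w j) ≡ false

  SamePattern : Labelling → Labelling → Set
  SamePattern ℓ ℓ′ = ∀ i j → sameLabel ℓ i j ≡ sameLabel ℓ′ i j

  SamePatternOff : Fin m → Labelling → Labelling → Set
  SamePatternOff k ℓ ℓ′ = ∀ i j → i ≢ k → j ≢ k → sameLabel ℓ i j ≡ sameLabel ℓ′ i j

  samePattern? : ∀ ℓ ℓ′ → Dec (SamePattern ℓ ℓ′)
  samePattern? ℓ ℓ′ = all? λ i → all? λ j → sameLabel ℓ i j Bool.≟ sameLabel ℓ′ i j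

  samePatternOff? : ∀ k ℓ ℓ′ → Dec (SamePatternOff k ℓ ℓ′)
  samePatternOff? k ℓ ℓ′ = all? λ i → all? λ j →
    ¬? (i ≟ k) →-dec ¬? (j ≟ k) →-dec sameLabel ℓ i j Bool.≟ sameLabel ℓ′ i j

  private
    Special : Fin n → Set
    Special x = ∃ λ i → w i ≡ x

    special? : ∀ x → Dec (Special x)
    special? x = any? λ i → w i ≟ x

    module _ (ℓ : Labelling) where

      sameᴸ : ∀ {x y} → Dec (Special x) → Dec (Special y) → Bool
      sameᴸ (yes (i , _)) (yes (j , _)) = sameLabel ℓ i j
      sameᴸ (yes _)       (no _)        = false
      sameᴸ (no _)        (yes _)       = false
      sameᴸ {x} {y} (no _) (no _)       = same P x y

      sameᴸ-refl : ∀ {x} (dx : Dec (Special x)) → sameᴸ dx dx ≡ true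
      sameᴸ-refl (yes (i , _)) = dec-true (ℓ i ℕ.≟ ℓ i) refl
      sameᴸ-refl {x} (no _)    = same-refl P x

      sameᴸ-sym : ∀ {x y} (dx : Dec (Special x)) (dy : Dec (Special y)) → sameᴸ dx dy ≡ sameᴸ dy dx
      sameᴸ-sym (yes (i , _)) (yes (j , _)) = does-⇔ (mk⇔ sym sym) (ℓ i ℕ.≟ ℓ j) (ℓ j ℕ.≟ ℓ i)
      sameᴸ-sym (yes _)       (no _)        = refl
      sameᴸ-sym (no _)        (yes _)       = refl
      sameᴸ-sym {x} {y} (no _) (no _)       = same-sym P x y

      sameᴸ-trans : ∀ {x y z} (dx : Dec (Special x)) (dy : Dec (Special y)) (dz : Dec (Special z)) →
        sameᴸ dx dy ≡ true → sameᴸ dy dz ≡ true → sameᴸ dx dz ≡ true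
      sameᴸ-trans (yes (i , _)) (yes (j , _)) (yes (k , _)) ij jk =
        dec-true (ℓ i ℕ.≟ ℓ k) (trans (does-sound (ℓ i ℕ.≟ ℓ j) ij) (does-sound (ℓ j ℕ.≟ ℓ k) jk))
      sameᴸ-trans {x} {y} {z} (no _) (no _) (no _) xy yz = same-trans P x y z xy yz
      sameᴸ-trans (yes _) (no _)  _       ()
      sameᴸ-trans (no _)  (yes _) _       ()
      sameᴸ-trans (yes _) (yes _) (no _)  _  ()
      sameᴸ-trans (no _)  (no _)  (yes _) _  ()

      sameᴸ-indep : Valid ℓ → ∀ {x y} (dx : Dec (Special x)) (dy : Dec (Special y)) →
        sameᴸ dx dy ≡ true → adj G x y ≡ false
      sameᴸ-indep valid (yes (i , refl)) (yes (j , refl)) ij = valid i j (does-sound (ℓ i ℕ.≟ ℓ j) ij)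
      sameᴸ-indep valid {x} {y} (no _) (no _) xy          = indep P x y xy

      sameᴸ-special : ∀ {i j} (dx : Dec (Special (w i))) (dy : Dec (Special (w j))) → sameᴸ dx dy ≡ sameLabel ℓ i j
      sameᴸ-special (yes (i′ , e)) (yes (j′ , e′)) rewrite w-injective e | w-injective e′ = refl
      sameᴸ-special {i} (no ¬special) _ = contradiction (i , refl) ¬special
      sameᴸ-special {j = j} (yes _) (no ¬special) = contradiction (j , refl) ¬special

  relabel : (ℓ : Labelling) → Valid ℓ → ISPartition G
  relabel ℓ valid = record
    { same       = λ x y → sameᴸ ℓ (special? x) (special? y)
    ; same-refl  = λ x → sameᴸ-refl ℓ (special? x)
    ; same-sym   = λ x y → sameᴸ-sym ℓ (special? x) (special? y)
    ; same-trans = λ x y z → sameᴸ-trans ℓ (special? x) (special? y) (special? z)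
    ; indep      = λ x y → sameᴸ-indep ℓ valid (special? x) (special? y)
    }

  module _ {ℓ : Labelling} {valid : Valid ℓ} where

    same-relabel : ∀ i j → same (relabel ℓ valid) (w i) (w j) ≡ sameLabel ℓ i j
    same-relabel i j = sameᴸ-special ℓ (special? (w i)) (special? (w j))

    relabel-alone : ∀ i → (∀ j → ℓ j ≡ ℓ i → j ≡ i) → ∀ z → same (relabel ℓ valid) (w i) z ≡ true → z ≡ w i
    relabel-alone i unique z with special? (w i) | special? z
    ... | yes (i′ , wi′≡wi) | yes (j , refl) = λ siz →
      cong w (unique j (trans (sym (does-sound (ℓ i′ ℕ.≟ ℓ j) siz)) (cong ℓ (w-injective wi′≡wi))))
    ... | yes _ | no _ = λ ()
    ... | no ¬special | _ = contradiction (i , refl) ¬special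

  module _ {ℓ ℓ′ : Labelling} {valid : Valid ℓ} {valid′ : Valid ℓ′} where

    relabel-agreeOff : ∀ k → SamePatternOff k ℓ ℓ′ → AgreeOff (w k) (relabel ℓ valid) (relabel ℓ′ valid′)
    relabel-agreeOff k samePattern x y x≢wk y≢wk with special? x | special? y
    ... | yes (i , refl) | yes (j , refl) = samePattern i j (x≢wk ∘ cong w) (y≢wk ∘ cong w)
    ... | yes _ | no _  = refl
    ... | no _  | yes _ = refl
    ... | no _  | no _  = refl

    private
      sameLabel-≡ : ∀ i j → same (relabel ℓ valid) (w i) (w j) ≡ same (relabel ℓ′ valid′) (w i) (w j) →
        sameLabel ℓ i j ≡ sameLabel ℓ′ i j
      sameLabel-≡ i j e = trans (sym (same-relabel {ℓ} {valid} i j)) (trans e (same-relabel {ℓ′} {valid′} i j))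

    relabel-≉ : ¬ SamePattern ℓ ℓ′ → ¬ relabel ℓ valid ≈P relabel ℓ′ valid′
    relabel-≉ different ≈ = different λ i j → sameLabel-≡ i j (≈ (w i) (w j))

    relabel-¬agreeOff : ¬ SamePattern ℓ ℓ′ → (∀ k → ¬ SamePatternOff k ℓ ℓ′) →
      ∀ x → ¬ AgreeOff x (relabel ℓ valid) (relabel ℓ′ valid′)
    relabel-¬agreeOff different differentOff x agree with special? x
    ... | yes (k , refl) = differentOff k λ i j i≢k j≢k →
      sameLabel-≡ i j (agree (w i) (w j) (i≢k ∘ w-injective) (j≢k ∘ w-injective))
    ... | no ¬special = different λ i j →
      sameLabel-≡ i j (agree (w i) (w j) (λ e → ¬special (i , e)) (λ e → ¬special (j , e)))

  module _ {ℓ : Labelling} (P-pattern : ∀ i j → same P (w i) (w j) ≡ sameLabel ℓ i j) where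

    private
      ¬same-outside : ∀ i {y} → ¬ Special y → same P (w i) y ≢ true
      ¬same-outside i ¬special siy with j , y≡wj ← w-closed i _ siy = ¬special (j , sym y≡wj)

    P≈relabel : ∀ {valid} → P ≈P relabel ℓ valid
    P≈relabel x y with special? x | special? y
    ... | yes (i , refl) | yes (j , refl) = P-pattern i j
    ... | yes (i , refl) | no ¬special    = ¬-not (¬same-outside i ¬special)
    ... | no ¬special    | yes (j , refl) = ¬-not (¬same-outside j ¬special ∘ trans (same-sym P (w j) x))
    ... | no _           | no _           = refl

module _ {n : ℕ} {G : Graph n} where

  Adjacent : ISPartition G → ISPartition G → Set
  Adjacent X Y = ¬ X ≈P Y × ∃ λ x → AgreeOff x X Y

  AgreeOff-≈ˡ : ∀ {X X′ Y : ISPartition G} {x : Fin n} → X ≈P X′ → AgreeOff x X′ Y → AgreeOff x X Y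
  AgreeOff-≈ˡ X≈X′ agree a b a≢x b≢x = trans (X≈X′ a b) (agree a b a≢x b≢x)

  Adjacent-≈ˡ : ∀ {X X′ Y : ISPartition G} → X ≈P X′ → Adjacent X′ Y → Adjacent X Y
  Adjacent-≈ˡ {X} {X′} {Y} X≈X′ (X′≉Y , x , agree) =
    (λ X≈Y → X′≉Y λ a b → trans (sym (X≈X′ a b)) (X≈Y a b)) , x , AgreeOff-≈ˡ {X} {X′} {Y} X≈X′ agree

  InB-mono : (M : Mode n) {X Y : ISPartition G} → numParts X ≤ numParts Y → InB M X → InB M Y
  InB-mono full          _   _   = tt
  InB-mono (atLeast _ _) X≤Y k≤X = ≤-trans k≤X X≤Y

¬noneOrTwo : ∀ {A B C : Set} → A → ¬ B → ¬ C →
  ¬ ((¬ A × ¬ B × ¬ C) ⊎ (A × B × ¬ C) ⊎ (A × ¬ B × C) ⊎ (¬ A × B × C))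
¬noneOrTwo a _  _  (inj₁ (¬a , _))                  = ¬a a
¬noneOrTwo _ ¬b _  (inj₂ (inj₁ (_ , b , _)))        = ¬b b
¬noneOrTwo _ _  ¬c (inj₂ (inj₂ (inj₁ (_ , _ , c)))) = ¬c c
¬noneOrTwo a _  _  (inj₂ (inj₂ (inj₂ (¬a , _))))    = ¬a a

module _ {n : ℕ} {G : Graph n} (M : Mode n) (P : ISPartition G) (P∈𝓑 : InB M P)
  (u : Fin 3 → Fin n) (u-injective : Injective _≡_ _≡_ u)
  (u-same : ∀ i j → same P (u i) (u j) ≡ true)
  (u-part : ∀ x → same P (u 0F) x ≡ true → ∃ λ i → x ≡ u i)
  (v : Fin n) (v-alone : ∀ x → same P v x ≡ true → x ≡ v)
  (u₀v-nonadjacent : adj G (u 0F) v ≡ false) where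

  private
    u≢v : ∀ i → u i ≢ v
    u≢v i uᵢ≡v = 0≢1 (u-injective (trans (alone 0F) (sym (alone 1F))))
      where
      0≢1 : 0F ≢ 1F
      0≢1 ()
      alone : ∀ j → u j ≡ v
      alone j = v-alone (u j) (subst (λ z → same P z (u j) ≡ true) uᵢ≡v (u-same i j))

    w : Fin 4 → Fin n
    w = v ∷ u

    w-injective : Injective _≡_ _≡_ w
    w-injective {0F}    {0F}    _     = refl
    w-injective {0F}    {suc j} v≡uⱼ  = contradiction (sym v≡uⱼ) (u≢v j)
    w-injective {suc i} {0F}    uᵢ≡v  = contradiction uᵢ≡v (u≢v i)
    w-injective {suc i} {suc j} uᵢ≡uⱼ = cong suc (u-injective uᵢ≡uⱼ)

    w-closed : ∀ i x → same P (w i) x ≡ true → ∃ λ j → x ≡ w j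
    w-closed 0F      x svx  = 0F , v-alone x svx
    w-closed (suc i) x suᵢx with j , x≡uⱼ ← u-part x (same-trans P (u 0F) (u i) x (u-same 0F i) suᵢx) = suc j , x≡uⱼ

  open Relabelling P w w-injective w-closed

  OnlyU₀WithV : Labelling → Set
  OnlyU₀WithV ℓ = ∀ i → ℓ 0F ≡ ℓ (suc i) → i ≡ 0F

  onlyU₀WithV? : ∀ ℓ → Dec (OnlyU₀WithV ℓ)
  onlyU₀WithV? ℓ = all? λ i → (ℓ 0F ℕ.≟ ℓ (suc i)) →-dec (i ≟ 0F)

  Valid-onlyU₀WithV : ∀ {ℓ} → OnlyU₀WithV ℓ → Valid ℓ
  Valid-onlyU₀WithV only 0F      0F      _     = adj-irr G v
  Valid-onlyU₀WithV only 0F      (suc j) ℓ₀≡ℓⱼ with refl ← only j ℓ₀≡ℓⱼ =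
    trans (adj-sym G v (u 0F)) u₀v-nonadjacent
  Valid-onlyU₀WithV only (suc i) 0F      ℓᵢ≡ℓ₀ with refl ← only i (sym ℓᵢ≡ℓ₀) = u₀v-nonadjacent
  Valid-onlyU₀WithV only (suc i) (suc j) _     = indep P (u i) (u j) (u-same i j)

  valid : ∀ {ℓ} → True (onlyU₀WithV? ℓ) → Valid ℓ
  valid only = Valid-onlyU₀WithV (toWitness only)

  ⟦_⟧ : (ℓ : Labelling) → {True (onlyU₀WithV? ℓ)} → ISPartition G
  ⟦ ℓ ⟧ {only} = relabel ℓ (valid only)

  distinct : ∀ ℓ ℓ′ {only only′} → {different : False (samePattern? ℓ ℓ′)} → ¬ (⟦ ℓ ⟧ {only}) ≈P (⟦ ℓ′ ⟧ {only′})
  distinct ℓ ℓ′ {only} {only′} {different} =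
    relabel-≉ {ℓ} {ℓ′} {valid only} {valid only′} (toWitnessFalse different)

  agreeOff : ∀ ℓ ℓ′ {only only′} k → {sameOff : True (samePatternOff? k ℓ ℓ′)} →
    AgreeOff (w k) (⟦ ℓ ⟧ {only}) (⟦ ℓ′ ⟧ {only′})
  agreeOff ℓ ℓ′ {only} {only′} k {sameOff} =
    relabel-agreeOff {ℓ} {ℓ′} {valid only} {valid only′} k (toWitness sameOff)

  adjacent : ∀ ℓ ℓ′ {only only′} k → {different : False (samePattern? ℓ ℓ′)} → {sameOff : True (samePatternOff? k ℓ ℓ′)} →
    Adjacent (⟦ ℓ ⟧ {only}) (⟦ ℓ′ ⟧ {only′})
  adjacent ℓ ℓ′ {only} {only′} k {different} {sameOff} =
    distinct ℓ ℓ′ {only} {only′} {different} , w k , agreeOff ℓ ℓ′ {only} {only′} k {sameOff}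

  ¬adjacent : ∀ ℓ ℓ′ {only only′} → {different : False (samePattern? ℓ ℓ′)} →
    {differentOff : True (all? λ k → ¬? (samePatternOff? k ℓ ℓ′))} → ¬ Adjacent (⟦ ℓ ⟧ {only}) (⟦ ℓ′ ⟧ {only′})
  ¬adjacent ℓ ℓ′ {only} {only′} {different} {differentOff} (_ , x , agree) =
    relabel-¬agreeOff {ℓ} {ℓ′} {valid only} {valid only′} (toWitnessFalse different) (toWitness differentOff) x agree

  numParts-isolate⟦_⟧ : ∀ ℓ {only} X k j →
    {unique : True (all? λ i → (ℓ i ℕ.≟ ℓ k) →-dec (i ≟ k))} → {j≢k : False (j ≟ k)} →
    AgreeOff (w k) X (⟦ ℓ ⟧ {only}) → same X (w k) (w j) ≡ true → numParts (⟦ ℓ ⟧ {only}) ≡ suc (numParts X)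
  numParts-isolate⟦ ℓ ⟧ {only} X k j {unique} {j≢k} agree partner =
    numParts-isolate {X = X} {Y = ⟦ ℓ ⟧ {only}} {x = w k} {y = w j}
      agree (relabel-alone {ℓ} {valid only} k (toWitness unique)) (toWitnessFalse j≢k ∘ w-injective) partner

  -- labels of v, u₀, u₁, u₂ in this order
  ℓP ℓQ₁ ℓQ₂ ℓQ₃ ℓR ℓS : Labelling
  ℓP  = 0 ∷ λ _ → 1
  ℓQ₁ = 0 ∷ 2 ∷ 1 ∷ 1 ∷ []
  ℓQ₂ = 0 ∷ 1 ∷ 2 ∷ 1 ∷ []
  ℓQ₃ = 0 ∷ 1 ∷ 1 ∷ 2 ∷ []
  ℓR  = 0 ∷ 1 ∷ 2 ∷ 3 ∷ []
  ℓS  = 0 ∷ 0 ∷ 1 ∷ 1 ∷ []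

  Q₁ Q₂ Q₃ R S : ISPartition G
  Q₁ = ⟦ ℓQ₁ ⟧
  Q₂ = ⟦ ℓQ₂ ⟧
  Q₃ = ⟦ ℓQ₃ ⟧
  R  = ⟦ ℓR ⟧
  S  = ⟦ ℓS ⟧

  P-pattern : ∀ i j → same P (w i) (w j) ≡ sameLabel ℓP i j
  P-pattern 0F      0F      = same-refl P v
  P-pattern 0F      (suc j) = ¬-not (u≢v j ∘ v-alone (u j))
  P-pattern (suc i) 0F      = ¬-not (u≢v i ∘ v-alone (u i) ∘ trans (same-sym P v (u i)))
  P-pattern (suc i) (suc j) = u-same i j

  P≈⟦ℓP⟧ : P ≈P ⟦ ℓP ⟧
  P≈⟦ℓP⟧ = P≈relabel P-pattern {valid _}

  P-agreeOff : ∀ ℓ {only} k → {sameOff : True (samePatternOff? k ℓP ℓ)} → AgreeOff (w k) P (⟦ ℓ ⟧ {only})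
  P-agreeOff ℓ {only} k {sameOff} =
    AgreeOff-≈ˡ {X = P} {X′ = ⟦ ℓP ⟧} {Y = ⟦ ℓ ⟧ {only}} P≈⟦ℓP⟧
      (agreeOff ℓP ℓ {only′ = only} k {sameOff})

  P-adjacent : ∀ ℓ {only} k → {different : False (samePattern? ℓP ℓ)} → {sameOff : True (samePatternOff? k ℓP ℓ)} →
    Adjacent P (⟦ ℓ ⟧ {only})
  P-adjacent ℓ {only} k {different} {sameOff} =
    Adjacent-≈ˡ {X = P} {X′ = ⟦ ℓP ⟧} {Y = ⟦ ℓ ⟧ {only}} P≈⟦ℓP⟧
      (adjacent ℓP ℓ {only′ = only} k {different} {sameOff})

  Q₁-parts : numParts Q₁ ≡ suc (numParts P)
  Q₁-parts = numParts-isolate⟦ ℓQ₁ ⟧ P 1F 2F (P-agreeOff ℓQ₁ 1F) (u-same 0F 1F)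

  Q₂-parts : numParts Q₂ ≡ suc (numParts P)
  Q₂-parts = numParts-isolate⟦ ℓQ₂ ⟧ P 2F 1F (P-agreeOff ℓQ₂ 2F) (u-same 1F 0F)

  Q₃-parts : numParts Q₃ ≡ suc (numParts P)
  Q₃-parts = numParts-isolate⟦ ℓQ₃ ⟧ P 3F 1F (P-agreeOff ℓQ₃ 3F) (u-same 2F 0F)

  R-parts : numParts R ≡ suc (numParts Q₁)
  R-parts = numParts-isolate⟦ ℓR ⟧ Q₁ 2F 3F (agreeOff ℓQ₁ ℓR 2F) (same-relabel {valid = valid _} 2F 3F)

  S-parts : numParts Q₁ ≡ suc (numParts S)
  S-parts = numParts-isolate⟦ ℓQ₁ ⟧ S 1F 0F (agreeOff ℓS ℓQ₁ 1F) (same-relabel {valid = valid _} 1F 0F)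

  Q₁∈𝓑 : InB M Q₁
  Q₁∈𝓑 = InB-mono M (m≡1+n⇒n≤m Q₁-parts) P∈𝓑

  Q₂∈𝓑 : InB M Q₂
  Q₂∈𝓑 = InB-mono M (m≡1+n⇒n≤m Q₂-parts) P∈𝓑

  Q₃∈𝓑 : InB M Q₃
  Q₃∈𝓑 = InB-mono M (m≡1+n⇒n≤m Q₃-parts) P∈𝓑

  R∈𝓑 : InB M R
  R∈𝓑 = InB-mono M (m≡1+n⇒n≤m R-parts) Q₁∈𝓑

  S∈𝓑 : InB M S
  S∈𝓑 = InB-mono M (≤-reflexive (suc-injective (trans (sym Q₁-parts) S-parts))) P∈𝓑

  ¬Property2 : ¬ Property2 M P
  ¬Property2 property2 = ¬noneOrTwo S~Q₁ S≁Q₂ S≁Q₃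
    (property2 Q₁ Q₂ Q₃ R
      (P∈𝓑 , Q₁∈𝓑 , P-adjacent ℓQ₁ 1F) (P∈𝓑 , Q₂∈𝓑 , P-adjacent ℓQ₂ 2F) (P∈𝓑 , Q₃∈𝓑 , P-adjacent ℓQ₃ 3F)
      (Q₁∈𝓑 , Q₂∈𝓑 , adjacent ℓQ₁ ℓQ₂ 3F) (Q₁∈𝓑 , Q₃∈𝓑 , adjacent ℓQ₁ ℓQ₃ 2F) (Q₂∈𝓑 , Q₃∈𝓑 , adjacent ℓQ₂ ℓQ₃ 1F)
      (Q₁∈𝓑 , R∈𝓑 , adjacent ℓQ₁ ℓR 2F) (Q₂∈𝓑 , R∈𝓑 , adjacent ℓQ₂ ℓR 1F) (Q₃∈𝓑 , R∈𝓑 , adjacent ℓQ₃ ℓR 1F)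
      R≉P P≁R
      S (P∈𝓑 , S∈𝓑 , P-adjacent ℓS 1F) (distinct ℓS ℓQ₁) (distinct ℓS ℓQ₂) (distinct ℓS ℓQ₃))
    where
    S~Q₁ : AdjB M S Q₁
    S~Q₁ = S∈𝓑 , Q₁∈𝓑 , adjacent ℓS ℓQ₁ 1F
    S≁Q₂ : ¬ AdjB M S Q₂
    S≁Q₂ = ¬adjacent ℓS ℓQ₂ ∘ proj₂ ∘ proj₂
    S≁Q₃ : ¬ AdjB M S Q₃
    S≁Q₃ = ¬adjacent ℓS ℓQ₃ ∘ proj₂ ∘ proj₂
    R≉P : ¬ R ≈P P
    R≉P R≈P = distinct ℓR ℓP λ x y → trans (R≈P x y) (P≈⟦ℓP⟧ x y)
    P≁R : ¬ AdjB M P R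
    P≁R (_ , _ , P~R) =
      ¬adjacent ℓP ℓR (Adjacent-≈ˡ {X = ⟦ ℓP ⟧} {X′ = P} {Y = R} (λ x y → sym (P≈⟦ℓP⟧ x y)) P~R)

module _ {n k : ℕ} {G : Graph n} (P : ISPartition G) (u : Fin (suc k) → Fin n) (π : Permutation′ (suc k)) where

  injective-∘π : Injective _≡_ _≡_ u → Injective _≡_ _≡_ (u ∘ (π ⟨$⟩ʳ_))
  injective-∘π u-injective {i} {j} e = begin
    i                    ≡⟨ inverseˡ π ⟨
    π ⟨$⟩ˡ (π ⟨$⟩ʳ i)    ≡⟨ cong (π ⟨$⟩ˡ_) (u-injective e) ⟩
    π ⟨$⟩ˡ (π ⟨$⟩ʳ j)    ≡⟨ inverseˡ π ⟩
    j                    ∎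
    where open ≡-Reasoning

  part-∘π : (∀ i j → same P (u i) (u j) ≡ true) → (∀ x → same P (u zero) x ≡ true → ∃ λ i → x ≡ u i) →
    ∀ x → same P (u (π ⟨$⟩ʳ zero)) x ≡ true → ∃ λ i → x ≡ u (π ⟨$⟩ʳ i)
  part-∘π u-same u-part x sx with i , x≡uᵢ ← u-part x (same-trans P _ _ x (u-same zero (π ⟨$⟩ʳ zero)) sx) =
    π ⟨$⟩ˡ i , trans x≡uᵢ (cong u (sym (inverseʳ π)))

lemma2p7 : {n : ℕ} (G : Graph n) (M : Mode n) (P : ISPartition G) → InB M P →
    (u : Fin 3 → Fin n) → Injective _≡_ _≡_ u →
    (∀ i j → same P (u i) (u j) ≡ true) →
    (∀ x → same P (u zero) x ≡ true → ∃ (λ i → x ≡ u i)) →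
    (v : Fin n) → (∀ x → same P v x ≡ true → x ≡ v) →
    ∃ (λ j → adj G (u j) v ≡ false) →
    ¬ Property2 M P
lemma2p7 G M P P∈𝓑 u u-injective u-same u-part v v-alone (j , uⱼv-nonadjacent) =
  ¬Property2 M P P∈𝓑 (u ∘ (π ⟨$⟩ʳ_)) (injective-∘π P u π u-injective) (λ _ _ → u-same _ _)
    (part-∘π P u π u-same u-part) v v-alone uⱼv-nonadjacent
  where
  π = transpose 0F j
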